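{- Let $n\ge0$, $S_1\subseteq\mathcal{D}_1$, $S_2\subseteq\mathcal{D}_2$ on the maximal Dyck path $\mathcal{D}^{(n+1)\times n}$. Then $(S_1,S_2)$ is a compatible pair if and only if $$\{\,j-i : u_i\in S_1,\ v_j\in S_2\,\}\cap\{0,1\}=\emptyset.$$
   Context: $\mathcal{D}=\mathcal{D}^{(n+1)\times n}$ is the lattice path from $(0,0)$ to $(n+1,n)$ with vertices $A_0=(0,0)$, $A_1=B_0=(1,0)$, and for $1\le i\le n$, $B_i=(i+1,i-1)$, $A_{i+1}=(i+1,i)$ (the highest unit up/right path not going strictly above the segment from $(0,0)$ to $(n+1,n)$). Horizontal edges $u_i=A_iB_i$ ($0\le i\le n$), $\mathcal{D}_1=\{u_0,\dots,u_n\}$; vertical edges $v_j=B_jA_{j+1}$ ($1\le j\le n$), $\mathcal{D}_2=\{v_1,\dots,v_n\}$. Identify $(n+1,n)$ with $(0,0)$. For lattice points $P,Q$ the subpath $PQ$ goes from $P$ northeast along $\mathcal{D}$ to $Q$, looping from $(n+1,n)$ to $(0,0)$ if needed (if $P=Q$, the full loop); $(PQ)_1,(PQ)_2$ are its horizontal/vertical edges, $(PQ)^\circ$ its lattice points other than $P,Q$. A pair $(S_1,S_2)$ is compatible if for all $u\in S_1$, $v\in S_2$, with $E$ the left endpoint of $u$ and $F$ the upper endpoint of $v$, there is $A\in(EF)^\circ$ with $|(AF)_1|=2|(AF)_2\cap S_2|$ or $|(EA)_2|=2|(EA)_1\cap S_1|$. -}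

module Defs where

open import Data.Nat using (ℕ; zero; suc; _+_; _*_; _∸_; _≤_; _<_; _≡ᵇ_)
open import Data.Nat.DivMod using (_%_)
open import Data.Bool using (Bool; true; false; if_then_else_)
open import Data.Fin using (Fin; toℕ) renaming (zero to fzero; suc to fsuc)
open import Data.Fin.Subset using (Subset; _∈_)
open import Data.Vec using (lookup)
open import Data.List using (List; []; _∷_; _++_; take; drop; concatMap; allFin; map)
open import Data.Nat.ListAction using (sum)
open import Data.Product using (Σ; ∃-syntax; _×_)
open import Data.Sum using (_⊎_)
open import Relation.Binary.PropositionalEquality using (_≡_)
open import Relation.Nullary using (¬_)

-- Edges of the maximal Dyck path D^{(n+1)×n}.
--   hE i  (i : Fin (suc n))  is the horizontal edge u_i   (0 ≤ i ≤ n)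
--   vE j  (j : Fin n)        is the vertical edge   v_{j+1} (1 ≤ j+1 ≤ n)
data Edge (n : ℕ) : Set where
  hE : Fin (suc n) → Edge n
  vE : Fin n → Edge n

N : ℕ → ℕ
N n = suc (2 * n)

-- Position m (0 ≤ m < N n) is the edge starting at lattice point number m,
-- where lattice points are numbered 0 = A_0, 1 = A_1 = B_0, 2 = B_1, 3 = A_2, ...
pathEdges : (n : ℕ) → List (Edge n)
pathEdges n = hE fzero ∷ concatMap (λ j → hE (fsuc j) ∷ vE j ∷ []) (allFin n)

leftEnd : {n : ℕ} → Fin (suc n) → ℕ
leftEnd fzero = 0
leftEnd (fsuc i) = suc (2 * toℕ i)

-- Position of the upper endpoint of v_{j+1}: point 2(j+1)+1, taken mod 2n+1
-- (the point (n+1,n) is identified with (0,0)).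
upperEnd : (n : ℕ) → Fin n → ℕ
upperEnd n j = (3 + 2 * toℕ j) % N n

-- Number of edges of the subpath PQ (P,Q given by positions in [0, N n)):
-- going northeast from P to Q, looping around; the full loop if P = Q.
subLen : (n p q : ℕ) → ℕ
subLen n p q with (q + N n ∸ p) % N n
... | zero = N n
... | suc d = suc d

segment : (n a l : ℕ) → List (Edge n)
segment n a l = take l (drop a (pathEdges n ++ pathEdges n))

bit : Bool → ℕ
bit true = 1
bit false = 0

isH : {n : ℕ} → Edge n → ℕ
isH (hE _) = 1
isH (vE _) = 0

isV : {n : ℕ} → Edge n → ℕ
isV (hE _) = 0
isV (vE _) = 1

inS₁ : {n : ℕ} → Subset (suc n) → Edge n → ℕ
inS₁ S₁ (hE i) = bit (lookup S₁ i)
inS₁ S₁ (vE _) = 0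

inS₂ : {n : ℕ} → Subset n → Edge n → ℕ
inS₂ S₂ (hE _) = 0
inS₂ S₂ (vE j) = bit (lookup S₂ j)

count : {n : ℕ} → (Edge n → ℕ) → List (Edge n) → ℕ
count f es = sum (map f es)

-- E = left endpoint of u_i at position p,
-- F = upper endpoint of v_j at position q, L = |EF|.  The interior points
-- of EF are the points at positions p + k with 1 ≤ k < L; for A = p + k,
-- EA consists of the first k edges of EF and AF of the remaining L - k.
Compatible : (n : ℕ) → Subset (suc n) → Subset n → Set
Compatible n S₁ S₂ =
  ∀ (i : Fin (suc n)) (j : Fin n) → i ∈ S₁ → j ∈ S₂ →
    let p = leftEnd i
        q = upperEnd n j
        L = subLen n p q
    in ∃[ k ] (1 ≤ k × k < L ×
         ( count isH (segment n (p + k) (L ∸ k))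
             ≡ 2 * count (inS₂ S₂) (segment n (p + k) (L ∸ k))
         ⊎ count isV (segment n p k)
             ≡ 2 * count (inS₁ S₁) (segment n p k)))

-- {j - i : u_i ∈ S₁, v_j ∈ S₂} ∩ {0,1} = ∅.
-- u_i is indexed by i (value toℕ i), v_j by j' : Fin n with j = toℕ j' + 1.
-- j - i ∈ {0,1}  ⇔  j ≡ i  or  j ≡ i + 1.
NoDiff01 : (n : ℕ) → Subset (suc n) → Subset n → Set
NoDiff01 n S₁ S₂ =
  ∀ (i : Fin (suc n)) (j : Fin n) → i ∈ S₁ → j ∈ S₂ →
    ¬ (suc (toℕ j) ≡ toℕ i) × ¬ (suc (toℕ j) ≡ suc (toℕ i))

-- If v_j comes right after u_i (j − i ∈ {0,1}) the path EF is u_i v_i, u_0 u_1 v_1 or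
-- u_i v_i u_{i+1} v_{i+1}, and no interior point A works.  Otherwise each block u_k v_k
-- of EF meets S₁ ∪ S₂ at most once and u_k ∈ S₁ forbids v_{k+1} ∈ S₂; since EF starts
-- in S₁ and ends in S₂, fewer than half of its edges lie in S₁ ∪ S₂.  Hence
-- 2|(EF)₁ ∩ S₁| < |(EF)₂| or 2|(EF)₂ ∩ S₂| < |(EF)₁|.  In the first case
-- |(EA)₂| − 2|(EA)₁ ∩ S₁| equals −2 after the first edge, is positive at F and rises by
-- at most one per edge, so it vanishes at an interior A; the second case is the same
-- argument for the suffixes AF.
module Submission where

open import Defs
open import Data.Nat
open import Data.Nat.Properties
open import Data.Nat.DivMod using (_%_; m<n⇒m%n≡m; n%n≡0; [m+n]%n≡m%n; m%n<n)
open import Data.Nat.ListAction using (sum)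
open import Data.Nat.ListAction.Properties using (sum-++)
open import Data.Nat.Tactic.RingSolver using (solve-∀)
open import Algebra.Properties.CommutativeSemigroup +-commutativeSemigroup using (interchange)
open import Data.Bool using (true; false)
open import Data.Fin using (Fin; toℕ) renaming (zero to fzero; suc to fsuc)
open import Data.Fin.Properties using (toℕ<n; toℕ-injective)
open import Data.Fin.Subset using (Subset; _∈_)
open import Data.Vec using (lookup)
open import Data.Vec.Properties using (lookup⇒[]=; []=⇒lookup)
open import Data.List using (List; []; _∷_; _++_; take; drop; length; map; concatMap; allFin; tabulate)
open import Data.List.Properties
  using (map-++; length-++; length-take; length-drop; length-tabulate; take-all; take-take; take-drop; drop-drop; ++-identityʳ)
open import Data.Product using (∃-syntax; _×_; _,_; proj₁; proj₂)
import Data.Sum as Sum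
open import Data.Sum using (_⊎_; inj₁; inj₂)
open import Data.Unit using (⊤; tt)
open import Data.Empty using (⊥-elim)
open import Function.Bundles using (_⇔_; mk⇔; Equivalence)
open import Relation.Binary.PropositionalEquality hiding (J)
open import Relation.Nullary using (¬_; yes; no)

-- The hypothesis says that a − b rises by at most one per step; being symmetric in a
-- and b, it covers crossings in either direction.
intermediate-value : (a b : ℕ → ℕ) → (∀ k → a (suc k) + b k ≤ suc (a k + b (suc k))) →
  ∀ lo d → a lo < b lo → b (lo + d) < a (lo + d) → ∃[ k ] (lo < k × k < lo + d × a k ≡ b k)
intermediate-value a b step lo zero a<b b<a =
  ⊥-elim (<-asym a<b (subst (λ x → b x < a x) (+-identityʳ lo) b<a))
intermediate-value a b step lo (suc d) a<b b<a with a (suc lo) <? b (suc lo)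
... | yes a<b′ with intermediate-value a b step (suc lo) d a<b′ (subst (λ x → b x < a x) (+-suc lo d) b<a)
...   | k , lo<k , k<hi , a≡b = k , <-trans (n<1+n lo) lo<k , subst (k <_) (sym (+-suc lo d)) k<hi , a≡b
intermediate-value a b step lo (suc d) a<b b<a | no a≮b′ = suc lo , n<1+n lo , lo<hi , a≡b
  where
    open ≤-Reasoning
    a≤b : a (suc lo) ≤ b (suc lo)
    a≤b = +-cancelʳ-≤ (b lo) _ _ (begin
      a (suc lo) + b lo        ≤⟨ step lo ⟩
      suc (a lo) + b (suc lo)  ≤⟨ +-monoˡ-≤ (b (suc lo)) a<b ⟩
      b lo + b (suc lo)        ≡⟨ +-comm (b lo) _ ⟩
      b (suc lo) + b lo        ∎)
    a≡b : a (suc lo) ≡ b (suc lo)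
    a≡b = ≤-antisym a≤b (≮⇒≥ a≮b′)
    lo<hi : suc lo < lo + suc d
    lo<hi = ≤∧≢⇒< (subst (suc lo ≤_) (sym (+-suc lo d)) (s≤s (m≤m+n lo d)))
                  (λ hi≡ → <-irrefl (sym (subst (λ x → a x ≡ b x) hi≡ a≡b)) b<a)

module _ {A : Set} where

  take-++ˡ : (xs ys : List A) (k : ℕ) → take (length xs + k) (xs ++ ys) ≡ xs ++ take k ys
  take-++ˡ []       ys k = refl
  take-++ˡ (x ∷ xs) ys k = cong (x ∷_) (take-++ˡ xs ys k)

  drop-++ˡ : (xs ys : List A) (k : ℕ) → drop (length xs + k) (xs ++ ys) ≡ drop k ys
  drop-++ˡ []       ys k = refl
  drop-++ˡ (x ∷ xs) ys k = drop-++ˡ xs ys k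

module _ {n : ℕ} where

  count-++ : (f : Edge n → ℕ) (xs ys : List (Edge n)) → count f (xs ++ ys) ≡ count f xs + count f ys
  count-++ f xs ys = trans (cong sum (map-++ f xs ys)) (sum-++ (map f xs) (map f ys))

  count-take-step : (f : Edge n → ℕ) → (∀ x → f x ≤ 1) → ∀ k xs →
                   count f (take (suc k) xs) ≤ suc (count f (take k xs))
  count-take-step f f≤1 zero    []       = z≤n
  count-take-step f f≤1 zero    (x ∷ xs) = +-monoˡ-≤ 0 (f≤1 x)
  count-take-step f f≤1 (suc k) []       = z≤n
  count-take-step f f≤1 (suc k) (x ∷ xs) =
    ≤-trans (+-monoʳ-≤ (f x) (count-take-step f f≤1 k xs)) (≤-reflexive (+-suc (f x) _))

  count-take-mono : (f : Edge n → ℕ) → ∀ k xs → count f (take k xs) ≤ count f (take (suc k) xs)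
  count-take-mono f zero    xs       = z≤n
  count-take-mono f (suc k) []       = z≤n
  count-take-mono f (suc k) (x ∷ xs) = +-monoʳ-≤ (f x) (count-take-mono f k xs)

  count-drop-step : (f : Edge n → ℕ) → (∀ x → f x ≤ 1) → ∀ k xs →
                   count f (drop k xs) ≤ suc (count f (drop (suc k) xs))
  count-drop-step f f≤1 zero    []       = z≤n
  count-drop-step f f≤1 zero    (x ∷ xs) = +-monoˡ-≤ (count f xs) (f≤1 x)
  count-drop-step f f≤1 (suc k) []       = z≤n
  count-drop-step f f≤1 (suc k) (x ∷ xs) = count-drop-step f f≤1 k xs

  count-drop-antimono : (f : Edge n → ℕ) → ∀ k xs → count f (drop (suc k) xs) ≤ count f (drop k xs)
  count-drop-antimono f zero    []       = z≤n
  count-drop-antimono f zero    (x ∷ xs) = m≤n+m (count f xs) (f x)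
  count-drop-antimono f (suc k) []       = z≤n
  count-drop-antimono f (suc k) (x ∷ xs) = count-drop-antimono f k xs

  prefix-crossing : (f g : Edge n → ℕ) → (∀ x → f x ≤ 1) → ∀ xs lo d →
    count f (take lo xs) < 2 * count g (take lo xs) →
    2 * count g (take (lo + d) xs) < count f (take (lo + d) xs) →
    ∃[ k ] (lo < k × k < lo + d × count f (take k xs) ≡ 2 * count g (take k xs))
  prefix-crossing f g f≤1 xs = intermediate-value
    (λ k → count f (take k xs)) (λ k → 2 * count g (take k xs))
    (λ k → +-mono-≤ (count-take-step f f≤1 k xs) (*-monoʳ-≤ 2 (count-take-mono g k xs)))

  suffix-crossing : (f g : Edge n → ℕ) → (∀ x → f x ≤ 1) → ∀ xs m →
    2 * count g xs < count f xs →
    count f (drop m xs) < 2 * count g (drop m xs) →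
    ∃[ k ] (0 < k × k < m × count f (drop k xs) ≡ 2 * count g (drop k xs))
  suffix-crossing f g f≤1 xs m 2g<f f<2g with intermediate-value
    (λ k → 2 * count g (drop k xs)) (λ k → count f (drop k xs))
    (λ k → ≤-trans (+-mono-≤ (*-monoʳ-≤ 2 (count-drop-antimono g k xs)) (count-drop-step f f≤1 k xs))
                   (≤-reflexive (+-suc _ _)))
    0 m 2g<f f<2g
  ... | k , 0<k , k<m , 2g≡f = k , 0<k , k<m , sym 2g≡f

  count-+ : (f g : Edge n → ℕ) (xs : List (Edge n)) →
            count (λ e → f e + g e) xs ≡ count f xs + count g xs
  count-+ f g []       = refl
  count-+ f g (x ∷ xs) =
    trans (cong (f x + g x +_) (count-+ f g xs)) (interchange (f x) (g x) (count f xs) (count g xs))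

  count-isH+isV : (s : List (Edge n)) → count isH s + count isV s ≡ length s
  count-isH+isV []         = refl
  count-isH+isV (hE _ ∷ s) = cong suc (count-isH+isV s)
  count-isH+isV (vE _ ∷ s) = trans (+-suc (count isH s) _) (cong suc (count-isH+isV s))

  isH≤1 : (e : Edge n) → isH e ≤ 1
  isH≤1 (hE _) = s≤s z≤n
  isH≤1 (vE _) = z≤n

  isV≤1 : (e : Edge n) → isV e ≤ 1
  isV≤1 (hE _) = z≤n
  isV≤1 (vE _) = s≤s z≤n

module Splitting (n : ℕ) (S₁ : Subset (suc n)) (S₂ : Subset n) where

  SplitsAt : List (Edge n) → ℕ → Set
  SplitsAt s k = count isH (drop k s) ≡ 2 * count (inS₂ S₂) (drop k s)
               ⊎ count isV (take k s) ≡ 2 * count (inS₁ S₁) (take k s)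

  Splittable : List (Edge n) → Set
  Splittable s = ∃[ k ] (1 ≤ k × k < length s × SplitsAt s k)

  weight : Edge n → ℕ
  weight e = inS₁ S₁ e + inS₂ S₂ e

  Sparse : List (Edge n) → Set
  Sparse s = 2 * count weight s < length s

  -- Sparseness gives 2|s₁ ∩ S₁| < |s₂| or 2|s₂ ∩ S₂| < |s₁|; the first edge (in S₁),
  -- resp. the last edge (in S₂), puts the other end of the crossing on the other side.
  sparse-splittable : ∀ i t m j → lookup S₁ i ≡ true → drop m (hE i ∷ t) ≡ vE j ∷ [] →
                      lookup S₂ j ≡ true → Sparse (hE i ∷ t) → Splittable (hE i ∷ t)
  sparse-splittable i t m j u∈ ends v∈ sparse
    with 2 * count (inS₁ S₁) (hE i ∷ t) <? count isV (hE i ∷ t)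
  ... | yes 2S₁<V with prefix-crossing isV (inS₁ S₁) isV≤1 s 1 (length t) (first-in-S₁ u∈)
                         (subst (λ x → 2 * count (inS₁ S₁) x < count isV x) (sym (take-all (length s) s ≤-refl)) 2S₁<V)
    where s = hE i ∷ t
          first-in-S₁ : lookup S₁ i ≡ true → count isV (take 1 s) < 2 * count (inS₁ S₁) (take 1 s)
          first-in-S₁ u∈ rewrite u∈ = s≤s z≤n
  ...   | k , 1<k , k<len , eq = k , <⇒≤ 1<k , k<len , inj₂ eq
  sparse-splittable i t m j u∈ ends v∈ sparse | no 2S₁≮V
    with suffix-crossing isH (inS₂ S₂) isH≤1 s m 2S₂<H (last-in-S₂ ends v∈)
    where
      s = hE i ∷ t
      S₁ᶜ = count (inS₁ S₁) s
      S₂ᶜ = count (inS₂ S₂) s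
      last-in-S₂ : drop m s ≡ vE j ∷ [] → lookup S₂ j ≡ true →
                   count isH (drop m s) < 2 * count (inS₂ S₂) (drop m s)
      last-in-S₂ ends v∈ rewrite ends | v∈ = s≤s z≤n
      open ≤-Reasoning
      2S₂<H : 2 * S₂ᶜ < count isH s
      2S₂<H = +-cancelˡ-< (2 * S₁ᶜ) _ _ (begin-strict
        2 * S₁ᶜ + 2 * S₂ᶜ              ≡⟨ sym (*-distribˡ-+ 2 S₁ᶜ S₂ᶜ) ⟩
        2 * (S₁ᶜ + S₂ᶜ)                ≡⟨ cong (2 *_) (sym (count-+ (inS₁ S₁) (inS₂ S₂) s)) ⟩
        2 * count weight s             <⟨ sparse ⟩
        length s                       ≡⟨ sym (count-isH+isV s) ⟩
        count isH s + count isV s      ≤⟨ +-monoʳ-≤ (count isH s) (≮⇒≥ 2S₁≮V) ⟩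
        count isH s + 2 * S₁ᶜ          ≡⟨ +-comm (count isH s) _ ⟩
        2 * S₁ᶜ + count isH s          ∎)
  ... | k , 0<k , k<m , eq = k , 0<k , <-trans k<m m<len , inj₁ eq
    where
      m<len : m < length (hE i ∷ t)
      m<len = m∸n≢0⇒n<m λ len∸m≡0 →
        1+n≢0 (trans (trans (cong length (sym ends)) (length-drop m (hE i ∷ t))) len∸m≡0)

module Path (n : ℕ) where

  -- block x is u_{x+1} v_{x+1}, and pathEdges n is definitionally hE fzero ∷ blocks (allFin n).
  block : Fin n → List (Edge n)
  block x = hE (fsuc x) ∷ vE x ∷ []

  blocks : List (Fin n) → List (Edge n)
  blocks = concatMap block

  run : ℕ → ℕ → List (Fin n)
  run a c = take c (drop a (allFin n))

  length-blocks : ∀ xs → length (blocks xs) ≡ 2 * length xs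
  length-blocks []       = refl
  length-blocks (x ∷ xs) = trans (cong (2 +_) (length-blocks xs)) (sym (*-suc 2 (length xs)))

  drop-blocks : ∀ a xs r → a ≤ length xs → drop (2 * a) (blocks xs ++ r) ≡ blocks (drop a xs) ++ r
  drop-blocks zero    xs       r _         = refl
  drop-blocks (suc a) (x ∷ xs) r (s≤s a≤) =
    subst (λ k → drop k (blocks (x ∷ xs) ++ r) ≡ blocks (drop a xs) ++ r) (sym (*-suc 2 a)) (drop-blocks a xs r a≤)

  take-blocks : ∀ c xs r → c ≤ length xs → take (2 * c) (blocks xs ++ r) ≡ blocks (take c xs)
  take-blocks zero    xs       r _         = refl
  take-blocks (suc c) (x ∷ xs) r (s≤s c≤) =
    subst (λ k → take k (blocks (x ∷ xs) ++ r) ≡ blocks (take (suc c) (x ∷ xs))) (sym (*-suc 2 c))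
          (cong (λ ys → hE (fsuc x) ∷ vE x ∷ ys) (take-blocks c xs r c≤))

  length-allFin : length (allFin n) ≡ n
  length-allFin = length-tabulate (λ x → x)

  length-pathEdges : length (pathEdges n) ≡ N n
  length-pathEdges = cong suc (trans (length-blocks (allFin n)) (cong (2 *_) length-allFin))

  length-drop-allFin : ∀ a → length (drop a (allFin n)) ≡ n ∸ a
  length-drop-allFin a = trans (length-drop a (allFin n)) (cong (_∸ a) length-allFin)

  length-run : ∀ a c → a + c ≤ n → length (run a c) ≡ c
  length-run a c a+c≤n = begin
    length (run a c)                ≡⟨ length-take c _ ⟩
    c ⊓ length (drop a (allFin n))  ≡⟨ cong (c ⊓_) (length-drop-allFin a) ⟩
    c ⊓ (n ∸ a)                     ≡⟨ m≤n⇒m⊓n≡m (m+n≤o⇒m≤o∸n c (subst (_≤ n) (+-comm a c) a+c≤n)) ⟩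
    c                               ∎
    where open ≡-Reasoning

  Consecutive : ℕ → List (Fin n) → Set
  Consecutive a []       = ⊤
  Consecutive a (x ∷ xs) = toℕ x ≡ a × Consecutive (suc a) xs

  consecutive-tabulate : ∀ {m} a (f : Fin m → Fin n) → (∀ k → toℕ (f k) ≡ a + toℕ k) →
                         Consecutive a (tabulate f)
  consecutive-tabulate {zero}  a f f≡ = tt
  consecutive-tabulate {suc m} a f f≡ =
    trans (f≡ fzero) (+-identityʳ a) ,
    consecutive-tabulate (suc a) (λ k → f (fsuc k)) (λ k → trans (f≡ (fsuc k)) (+-suc a (toℕ k)))

  consecutive-drop : ∀ k a xs → Consecutive a xs → Consecutive (a + k) (drop k xs)
  consecutive-drop zero    a xs       cons        = subst (λ b → Consecutive b xs) (sym (+-identityʳ a)) cons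
  consecutive-drop (suc k) a []       _           = tt
  consecutive-drop (suc k) a (x ∷ xs) (_ , cons) =
    subst (λ b → Consecutive b (drop k xs)) (sym (+-suc a k)) (consecutive-drop k (suc a) xs cons)

  consecutive-take : ∀ c a xs → Consecutive a xs → Consecutive a (take c xs)
  consecutive-take zero    a xs       _            = tt
  consecutive-take (suc c) a []       _            = tt
  consecutive-take (suc c) a (x ∷ xs) (x≡ , cons) = x≡ , consecutive-take c (suc a) xs cons

  consecutive-run : ∀ a c → Consecutive a (run a c)
  consecutive-run a c =
    consecutive-take c a _ (consecutive-drop a 0 (allFin n) (consecutive-tabulate 0 (λ k → k) (λ k → refl)))

  drop-allFin : (x : Fin n) → drop (toℕ x) (allFin n) ≡ x ∷ drop (suc (toℕ x)) (allFin n)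
  drop-allFin = go (λ k → k)
    where
      go : ∀ {m} (f : Fin m → Fin n) (x : Fin m) → drop (toℕ x) (tabulate f) ≡ f x ∷ drop (suc (toℕ x)) (tabulate f)
      go f fzero    = refl
      go f (fsuc x) = go (λ k → f (fsuc k)) x

  run-toℕ : (x : Fin n) (d : ℕ) → run (toℕ x) (suc d) ≡ x ∷ run (suc (toℕ x)) d
  run-toℕ x d = cong (take (suc d)) (drop-allFin x)

  lastOf : Fin n → List (Fin n) → Fin n
  lastOf x []       = x
  lastOf x (y ∷ ys) = lastOf y ys

  toℕ-lastOf : ∀ a x xs → Consecutive a (x ∷ xs) → toℕ (lastOf x xs) ≡ a + length xs
  toℕ-lastOf a x []       (x≡ , _)    = trans x≡ (sym (+-identityʳ a))
  toℕ-lastOf a x (y ∷ ys) (_ , cons) = trans (toℕ-lastOf (suc a) y ys cons) (sym (+-suc a (length ys)))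

  blocks-ends : ∀ x xs → ∃[ m ] (drop m (blocks (x ∷ xs)) ≡ vE (lastOf x xs) ∷ [])
  blocks-ends x []       = 1 , refl
  blocks-ends x (y ∷ ys) with blocks-ends y ys
  ... | m , ends = 2 + m , ends

  length-segment : ∀ p L → p + L ≤ N n + N n → length (segment n p L) ≡ L
  length-segment p L p+L≤ = begin
    length (segment n p L)       ≡⟨ length-take L _ ⟩
    L ⊓ length (drop p loop)     ≡⟨ cong (L ⊓_) (length-drop p loop) ⟩
    L ⊓ (length loop ∸ p)        ≡⟨ cong (λ l → L ⊓ (l ∸ p)) length-loop ⟩
    L ⊓ (N n + N n ∸ p)          ≡⟨ m≤n⇒m⊓n≡m (m+n≤o⇒m≤o∸n L (subst (_≤ N n + N n) (+-comm p L) p+L≤)) ⟩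
    L                            ∎
    where
      open ≡-Reasoning
      loop = pathEdges n ++ pathEdges n
      length-loop : length loop ≡ N n + N n
      length-loop = trans (length-++ (pathEdges n)) (cong₂ _+_ length-pathEdges length-pathEdges)

  segment-drop : ∀ p L k → k ≤ L → segment n (p + k) (L ∸ k) ≡ drop k (segment n p L)
  segment-drop p L k k≤L = begin
    take (L ∸ k) (drop (p + k) loop)            ≡⟨ cong (take (L ∸ k)) (sym (drop-drop p k loop)) ⟩
    take (L ∸ k) (drop k (drop p loop))         ≡⟨ take-drop (L ∸ k) k (drop p loop) ⟩
    drop k (take (k + (L ∸ k)) (drop p loop))   ≡⟨ cong (λ l → drop k (take l (drop p loop))) (m+[n∸m]≡n k≤L) ⟩
    drop k (take L (drop p loop))               ∎
    where open ≡-Reasoning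
          loop = pathEdges n ++ pathEdges n

  segment-take : ∀ p L k → k ≤ L → segment n p k ≡ take k (segment n p L)
  segment-take p L k k≤L =
    sym (trans (take-take k L _) (cong (λ l → take l (drop p (pathEdges n ++ pathEdges n))) (m≤n⇒m⊓n≡m k≤L)))

  ≤length-allFin : ∀ {a} → a ≤ n → a ≤ length (allFin n)
  ≤length-allFin = subst (_ ≤_) (sym length-allFin)

  segment-from-u₀ : ∀ c → c ≤ n → segment n 0 (suc (2 * c)) ≡ hE fzero ∷ blocks (run 0 c)
  segment-from-u₀ c c≤n = cong (hE fzero ∷_) (take-blocks c (allFin n) (pathEdges n) (≤length-allFin c≤n))

  segment-forward : ∀ a c → a + c ≤ n → segment n (suc (2 * a)) (2 * c) ≡ blocks (run a c)
  segment-forward a c a+c≤n = begin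
    take (2 * c) (drop (2 * a) (blocks (allFin n) ++ pathEdges n))
      ≡⟨ cong (take (2 * c)) (drop-blocks a (allFin n) (pathEdges n) (≤length-allFin (m+n≤o⇒m≤o a a+c≤n))) ⟩
    take (2 * c) (blocks (drop a (allFin n)) ++ pathEdges n)
      ≡⟨ take-blocks c (drop a (allFin n)) (pathEdges n) c≤ ⟩
    blocks (run a c) ∎
    where
      open ≡-Reasoning
      c≤ : c ≤ length (drop a (allFin n))
      c≤ = subst (c ≤_) (sym (length-drop-allFin a)) (m+n≤o⇒m≤o∸n c (subst (_≤ n) (+-comm a c) a+c≤n))

  segment-wrapping : ∀ a c → a ≤ n → c ≤ n →
    segment n (suc (2 * a)) (2 * (n ∸ a) + suc (2 * c)) ≡
    blocks (drop a (allFin n)) ++ hE fzero ∷ blocks (run 0 c)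
  segment-wrapping a c a≤n c≤n = begin
    take (2 * (n ∸ a) + suc (2 * c)) (drop (2 * a) (blocks (allFin n) ++ pathEdges n))
      ≡⟨ cong (take (2 * (n ∸ a) + suc (2 * c))) (drop-blocks a (allFin n) (pathEdges n) (≤length-allFin a≤n)) ⟩
    take (2 * (n ∸ a) + suc (2 * c)) (tail ++ pathEdges n)
      ≡⟨ cong (λ l → take (l + suc (2 * c)) (tail ++ pathEdges n)) (sym length-tail) ⟩
    take (length tail + suc (2 * c)) (tail ++ pathEdges n)
      ≡⟨ take-++ˡ tail (pathEdges n) (suc (2 * c)) ⟩
    tail ++ hE fzero ∷ take (2 * c) (blocks (allFin n))
      ≡⟨ cong (λ l → tail ++ hE fzero ∷ take (2 * c) l) (sym (++-identityʳ (blocks (allFin n)))) ⟩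
    tail ++ hE fzero ∷ take (2 * c) (blocks (allFin n) ++ [])
      ≡⟨ cong (λ l → tail ++ hE fzero ∷ l) (take-blocks c (allFin n) [] (≤length-allFin c≤n)) ⟩
    tail ++ hE fzero ∷ blocks (run 0 c) ∎
    where
      open ≡-Reasoning
      tail = blocks (drop a (allFin n))
      length-tail : length tail ≡ 2 * (n ∸ a)
      length-tail = trans (length-blocks (drop a (allFin n))) (cong (2 *_) (length-drop-allFin a))

  subLen-≡ : ∀ p q L → 1 ≤ L → L ≤ N n → p + L ≡ q ⊎ p + L ≡ q + N n → subLen n p q ≡ L
  subLen-≡ p q L 1≤L L≤N closes = from-residue (residue closes)
    where
      open ≡-Reasoning
      residue : p + L ≡ q ⊎ p + L ≡ q + N n → (q + N n ∸ p) % N n ≡ L % N n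
      residue (inj₁ p+L≡q) = begin
        (q + N n ∸ p) % N n       ≡⟨ cong (λ x → (x + N n ∸ p) % N n) (sym p+L≡q) ⟩
        (p + L + N n ∸ p) % N n   ≡⟨ cong (λ x → (x ∸ p) % N n) (+-assoc p L (N n)) ⟩
        (p + (L + N n) ∸ p) % N n ≡⟨ cong (_% N n) (m+n∸m≡n p (L + N n)) ⟩
        (L + N n) % N n           ≡⟨ [m+n]%n≡m%n L (N n) ⟩
        L % N n                   ∎
      residue (inj₂ p+L≡q+N) = cong (_% N n) (trans (cong (_∸ p) (sym p+L≡q+N)) (m+n∸m≡n p L))
      from-residue : (q + N n ∸ p) % N n ≡ L % N n → subLen n p q ≡ L
      from-residue r with (q + N n ∸ p) % N n | m≤n⇒m<n∨m≡n L≤N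
      ... | zero  | inj₁ L<N = ⊥-elim (<⇒≢ 1≤L (trans r (m<n⇒m%n≡m L<N)))
      ... | zero  | inj₂ L≡N = sym L≡N
      ... | suc d | inj₁ L<N = trans r (m<n⇒m%n≡m L<N)
      ... | suc d | inj₂ L≡N = ⊥-elim (1+n≢0 (trans r (trans (cong (_% N n) L≡N) (n%n≡0 (N n)))))

  subLen≤N : ∀ p q → subLen n p q ≤ N n
  subLen≤N p q with (q + N n ∸ p) % N n in r
  ... | zero  = ≤-refl
  ... | suc d = <⇒≤ (subst (_< N n) r (m%n<n (q + N n ∸ p) (N n)))

  leftEnd<N : (i : Fin (suc n)) → leftEnd i < N n
  leftEnd<N fzero    = s≤s z≤n
  leftEnd<N (fsuc i) = s≤s (*-monoʳ-< 2 (toℕ<n i))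

  upperEnd-inner : (j : Fin n) → suc (toℕ j) < n → upperEnd n j ≡ 3 + 2 * toℕ j
  upperEnd-inner j j+1<n = m<n⇒m%n≡m (s≤s (≤-trans (n≤1+n _) (≤-trans (≤-reflexive (e (toℕ j))) (*-monoʳ-≤ 2 j+1<n))))
    where e : ∀ J → suc (3 + 2 * J) ≡ 2 * suc (suc J)
          e = solve-∀

  upperEnd-last : (j : Fin n) → suc (toℕ j) ≡ n → upperEnd n j ≡ 0
  upperEnd-last j j+1≡n = trans (cong (_% N n) (sym N≡)) (n%n≡0 (N n))
    where N≡ : N n ≡ 3 + 2 * toℕ j
          N≡ = trans (cong (λ m → suc (2 * m)) (sym j+1≡n)) (cong suc (*-suc 2 (toℕ j)))

  arc : Fin (suc n) → Fin n → List (Edge n)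
  arc i j = segment n (leftEnd i) (subLen n (leftEnd i) (upperEnd n j))

  length-arc : (i : Fin (suc n)) (j : Fin n) → length (arc i j) ≡ subLen n (leftEnd i) (upperEnd n j)
  length-arc i j = length-segment (leftEnd i) _ (+-mono-≤ (<⇒≤ (leftEnd<N i)) (subLen≤N (leftEnd i) (upperEnd n j)))

  arc-from-u₀ : (j : Fin n) → arc fzero j ≡ hE fzero ∷ blocks (run 0 (suc (toℕ j)))
  arc-from-u₀ j = trans (cong (segment n 0) (subLen-≡ 0 (upperEnd n j) L (s≤s z≤n) L≤N closes))
                        (segment-from-u₀ (suc J) (toℕ<n j))
    where
      J = toℕ j
      L = suc (2 * suc J)
      L≤N : L ≤ N n
      L≤N = s≤s (*-monoʳ-≤ 2 (toℕ<n j))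
      closes : L ≡ upperEnd n j ⊎ L ≡ upperEnd n j + N n
      closes with m≤n⇒m<n∨m≡n (toℕ<n j)
      ... | inj₁ j+1<n = inj₁ (trans (cong suc (*-suc 2 J)) (sym (upperEnd-inner j j+1<n)))
      ... | inj₂ j+1≡n = inj₂ (trans (cong (λ m → suc (2 * m)) j+1≡n) (cong (_+ N n) (sym (upperEnd-last j j+1≡n))))

  arc-forward : (i j : Fin n) (d : ℕ) → toℕ j ≡ toℕ i + d → arc (fsuc i) j ≡ blocks (run (toℕ i) (suc d))
  arc-forward i j d j≡i+d = trans (cong (segment n p) (subLen-≡ p (upperEnd n j) L (s≤s z≤n) L≤N closes))
                                  (segment-forward I (suc d) fits)
    where
      I = toℕ i
      J = toℕ j
      p = suc (2 * I)
      L = 2 * suc d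
      fits : I + suc d ≤ n
      fits = subst (_≤ n) (trans (cong suc j≡i+d) (sym (+-suc I d))) (toℕ<n j)
      L≤N : L ≤ N n
      L≤N = ≤-trans (*-monoʳ-≤ 2 (≤-trans (m≤n+m (suc d) I) fits)) (n≤1+n _)
      p+L : ∀ I d → suc (2 * I) + 2 * suc d ≡ suc (2 * suc (I + d))
      p+L = solve-∀
      p+L≡ : p + L ≡ suc (2 * suc J)
      p+L≡ = trans (p+L I d) (cong (λ m → suc (2 * suc m)) (sym j≡i+d))
      closes : p + L ≡ upperEnd n j ⊎ p + L ≡ upperEnd n j + N n
      closes with m≤n⇒m<n∨m≡n (toℕ<n j)
      ... | inj₁ j+1<n = inj₁ (trans p+L≡ (trans (cong suc (*-suc 2 J)) (sym (upperEnd-inner j j+1<n))))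
      ... | inj₂ j+1≡n = inj₂ (trans p+L≡ (trans (cong (λ m → suc (2 * m)) j+1≡n) (cong (_+ N n) (sym (upperEnd-last j j+1≡n)))))

  arc-wrapping : (i j : Fin n) (d : ℕ) → toℕ i ≡ suc (toℕ j + d) →
                 arc (fsuc i) j ≡ blocks (drop (toℕ i) (allFin n)) ++ hE fzero ∷ blocks (run 0 (suc (toℕ j)))
  arc-wrapping i j d i≡j+1+d =
    trans (cong (segment n p) (subLen-≡ p (upperEnd n j) L (≤-trans (s≤s z≤n) (m≤n+m _ (2 * e))) L≤N (inj₂ closes)))
          (segment-wrapping I (suc J) (<⇒≤ (toℕ<n i)) (toℕ<n j))
    where
      open ≤-Reasoning
      I = toℕ i
      J = toℕ j
      e = n ∸ I
      p = suc (2 * I)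
      L = 2 * e + suc (2 * suc J)
      I+e≡n : I + e ≡ n
      I+e≡n = m+[n∸m]≡n (<⇒≤ (toℕ<n i))
      j+1≤i : suc J ≤ I
      j+1≤i = subst (suc J ≤_) (sym i≡j+1+d) (s≤s (m≤m+n J d))
      L≡ : ∀ e J → 2 * e + suc (2 * suc J) ≡ suc (2 * (suc J + e))
      L≡ = solve-∀
      L≤N : L ≤ N n
      L≤N = begin
        L                      ≡⟨ L≡ e J ⟩
        suc (2 * (suc J + e))  ≤⟨ s≤s (*-monoʳ-≤ 2 (+-monoˡ-≤ e j+1≤i)) ⟩
        suc (2 * (I + e))      ≡⟨ cong (λ m → suc (2 * m)) I+e≡n ⟩
        N n                    ∎
      p+L : ∀ I e J → suc (2 * I) + (2 * e + suc (2 * suc J)) ≡ 3 + 2 * J + suc (2 * (I + e))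
      p+L = solve-∀
      closes : p + L ≡ upperEnd n j + N n
      closes = trans (p+L I e J) (cong₂ (λ q m → q + suc (2 * m))
                 (sym (upperEnd-inner j (≤-trans (s≤s j+1≤i) (toℕ<n i)))) I+e≡n)

  run-view : ∀ a (j : Fin n) → a ≤ toℕ j →
             ∃[ y ] ∃[ ys ] (run a (suc (toℕ j ∸ a)) ≡ y ∷ ys × Consecutive a (y ∷ ys) ×
                             lastOf y ys ≡ j × length ys ≡ toℕ j ∸ a)
  run-view a j a≤j with run a (suc d) | consecutive-run a (suc d) | length-run a (suc d) fits
    where d = toℕ j ∸ a
          fits : a + suc d ≤ n
          fits = subst (_≤ n) (sym (trans (+-suc a d) (cong suc (m+[n∸m]≡n a≤j)))) (toℕ<n j)
  ... | y ∷ ys | cons | len = y , ys , refl , cons , last≡j , suc-injective len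
    where
      last≡j : lastOf y ys ≡ j
      last≡j = toℕ-injective (trans (toℕ-lastOf a y ys cons) (trans (cong (a +_) (suc-injective len)) (m+[n∸m]≡n a≤j)))

  arc-adjacent : (i j : Fin n) → toℕ j ≡ toℕ i → arc (fsuc i) j ≡ hE (fsuc i) ∷ vE j ∷ []
  arc-adjacent i j j≡i = trans (arc-forward i j 0 (trans j≡i (sym (+-identityʳ (toℕ i)))))
    (trans (cong blocks (run-toℕ i 0)) (cong (λ x → hE (fsuc i) ∷ vE x ∷ []) (toℕ-injective (sym j≡i))))

  arc-u₀-v₁ : (j : Fin n) → toℕ j ≡ 0 → arc fzero j ≡ hE fzero ∷ hE (fsuc j) ∷ vE j ∷ []
  arc-u₀-v₁ j j≡0 = trans (arc-from-u₀ j)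
    (cong (λ r → hE fzero ∷ blocks r) (trans (cong₂ run (sym j≡0) (cong suc j≡0)) (run-toℕ j 0)))

  arc-next : (i j : Fin n) → toℕ j ≡ suc (toℕ i) →
             arc (fsuc i) j ≡ hE (fsuc i) ∷ vE i ∷ hE (fsuc j) ∷ vE j ∷ []
  arc-next i j j≡i+1 = trans (arc-forward i j 1 (trans j≡i+1 (+-comm 1 (toℕ i))))
    (cong blocks (trans (run-toℕ i 1) (cong (i ∷_) (trans (cong (λ a → run a 1) (sym j≡i+1)) (run-toℕ j 0)))))

module Compatibility (n : ℕ) (S₁ : Subset (suc n)) (S₂ : Subset n) where
  open Path n
  open Splitting n S₁ S₂

  -- The body of Compatible, so that Compatible n S₁ S₂ unfolds to ∀ i j → i ∈ S₁ → j ∈ S₂ → CompatibleAt i j.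
  CompatibleAt : Fin (suc n) → Fin n → Set
  CompatibleAt i j =
    let p = leftEnd i
        q = upperEnd n j
        L = subLen n p q
    in ∃[ k ] (1 ≤ k × k < L ×
         ( count isH (segment n (p + k) (L ∸ k))
             ≡ 2 * count (inS₂ S₂) (segment n (p + k) (L ∸ k))
         ⊎ count isV (segment n p k)
             ≡ 2 * count (inS₁ S₁) (segment n p k)))

  compatibleAt⇔splittable : ∀ i j → CompatibleAt i j ⇔ Splittable (arc i j)
  compatibleAt⇔splittable i j = mk⇔
    (λ (k , 1≤k , k<L , splits) → k , 1≤k , subst (k <_) (sym (length-arc i j)) k<L ,
       Sum.map (subst (λ s → count isH s ≡ 2 * count (inS₂ S₂) s) (segment-drop p L k (<⇒≤ k<L)))
               (subst (λ s → count isV s ≡ 2 * count (inS₁ S₁) s) (segment-take p L k (<⇒≤ k<L))) splits)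
    (λ (k , 1≤k , k<len , splits) → let k<L = subst (k <_) (length-arc i j) k<len in k , 1≤k , k<L ,
       Sum.map (subst (λ s → count isH s ≡ 2 * count (inS₂ S₂) s) (sym (segment-drop p L k (<⇒≤ k<L))))
               (subst (λ s → count isV s ≡ 2 * count (inS₁ S₁) s) (sym (segment-take p L k (<⇒≤ k<L)))) splits)
    where
      p = leftEnd i
      L = subLen n p (upperEnd n j)

  unsplittable-adjacent : ∀ x y → lookup S₁ (fsuc x) ≡ true → lookup S₂ y ≡ true →
                          ¬ Splittable (hE (fsuc x) ∷ vE y ∷ [])
  unsplittable-adjacent x y u∈ v∈ (1 , _ , _ , split) rewrite u∈ | v∈ with split
  ... | inj₁ ()
  ... | inj₂ ()
  unsplittable-adjacent x y u∈ v∈ (suc (suc _) , _ , s≤s (s≤s ()) , _)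

  unsplittable-u₀-v₁ : ∀ y → lookup S₁ fzero ≡ true → lookup S₂ y ≡ true →
                       ¬ Splittable (hE fzero ∷ hE (fsuc y) ∷ vE y ∷ [])
  unsplittable-u₀-v₁ y u∈ v∈ (1 , _ , _ , split) rewrite u∈ | v∈ with split
  ... | inj₁ ()
  ... | inj₂ ()
  unsplittable-u₀-v₁ y u∈ v∈ (2 , _ , _ , split) rewrite u∈ | v∈ with split
  ... | inj₁ ()
  ... | inj₂ ()
  unsplittable-u₀-v₁ y u∈ v∈ (suc (suc (suc _)) , _ , s≤s (s≤s (s≤s ())) , _)

  unsplittable-next : ∀ x y → lookup S₁ (fsuc x) ≡ true → lookup S₂ y ≡ true →
                      ¬ Splittable (hE (fsuc x) ∷ vE x ∷ hE (fsuc y) ∷ vE y ∷ [])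
  unsplittable-next x y u∈ v∈ (1 , _ , _ , split) rewrite u∈ | v∈ with lookup S₂ x | split
  ... | false | inj₁ ()
  ... | true  | inj₁ ()
  ... | _     | inj₂ ()
  unsplittable-next x y u∈ v∈ (2 , _ , _ , split) rewrite u∈ | v∈ with split
  ... | inj₁ ()
  ... | inj₂ ()
  unsplittable-next x y u∈ v∈ (3 , _ , _ , split) rewrite u∈ | v∈ with lookup S₁ (fsuc y) | split
  ... | _     | inj₁ ()
  ... | false | inj₂ ()
  ... | true  | inj₂ ()
  unsplittable-next x y u∈ v∈ (suc (suc (suc (suc _))) , _ , s≤s (s≤s (s≤s (s≤s ()))) , _)

  module Sparsity (noDiff : NoDiff01 n S₁ S₂) where

    v∉S₂-if-j≡i : ∀ {i y} → lookup S₁ i ≡ true → suc (toℕ y) ≡ toℕ i → lookup S₂ y ≡ false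
    v∉S₂-if-j≡i {i} {y} u∈ j≡i with lookup S₂ y in v∈
    ... | false = refl
    ... | true  = ⊥-elim (proj₁ (noDiff i y (lookup⇒[]= i S₁ u∈) (lookup⇒[]= y S₂ v∈)) j≡i)

    v∉S₂-if-j≡i+1 : ∀ {i y} → lookup S₁ i ≡ true → toℕ y ≡ toℕ i → lookup S₂ y ≡ false
    v∉S₂-if-j≡i+1 {i} {y} u∈ j≡i+1 with lookup S₂ y in v∈
    ... | false = refl
    ... | true  = ⊥-elim (proj₂ (noDiff i y (lookup⇒[]= i S₁ u∈) (lookup⇒[]= y S₂ v∈)) (cong suc j≡i+1))

    blockWeight : List (Fin n) → ℕ
    blockWeight xs = count weight (blocks xs)

    blockWeight≤length : ∀ xs → blockWeight xs ≤ length xs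
    blockWeight≤length []       = z≤n
    blockWeight≤length (x ∷ xs) with lookup S₁ (fsuc x) in u∈
    ... | false = +-mono-≤ (bit≤1 (lookup S₂ x)) (blockWeight≤length xs)
      where bit≤1 : ∀ b → bit b ≤ 1
            bit≤1 false = z≤n
            bit≤1 true  = s≤s z≤n
    ... | true rewrite v∉S₂-if-j≡i u∈ refl = s≤s (blockWeight≤length xs)

    -- A block whose u is in S₁ forces the next block's v out of S₂, so blocks of
    -- weight one cannot run from a block with v ∉ S₂ up to one with v ∈ S₂.
    blockWeight<length : ∀ a x xs → Consecutive a (x ∷ xs) → lookup S₂ x ≡ false →
                         lookup S₂ (lastOf x xs) ≡ true → blockWeight (x ∷ xs) ≤ length xs
    blockWeight<length a x []       _ v∉ v∈ with trans (sym v∉) v∈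
    ... | ()
    blockWeight<length a x (y ∷ ys) (x≡a , y≡a+1 , cons) v∉ last∈ with lookup S₁ (fsuc x) in u∈
    ... | false rewrite v∉ = blockWeight≤length (y ∷ ys)
    ... | true  rewrite v∉ =
      s≤s (blockWeight<length (suc a) y ys (y≡a+1 , cons) (v∉S₂-if-j≡i+1 u∈ (trans y≡a+1 (cong suc (sym x≡a)))) last∈)

    weight-u₀∷blocks≤length : ∀ y ys → Consecutive 0 (y ∷ ys) → lookup S₂ (lastOf y ys) ≡ true →
                              count weight (hE fzero ∷ blocks (y ∷ ys)) ≤ suc (length ys)
    weight-u₀∷blocks≤length y ys (y≡0 , cons) last∈ with lookup S₁ fzero in u∈
    ... | false = blockWeight≤length (y ∷ ys)
    ... | true  = s≤s (blockWeight<length 0 y ys (y≡0 , cons) (v∉S₂-if-j≡i+1 u∈ y≡0) last∈)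

    splittable-from-u₀ : ∀ j → lookup S₁ fzero ≡ true → lookup S₂ j ≡ true → Splittable (arc fzero j)
    splittable-from-u₀ j u∈ v∈ with run-view 0 j z≤n
    ... | y , ys , run≡ , cons , refl , _ with blocks-ends y ys
    ...   | m , ends = subst Splittable (sym arc≡) (sparse-splittable fzero (blocks (y ∷ ys)) (suc m) _ u∈ ends v∈ sparse)
      where
        arc≡ : arc fzero j ≡ hE fzero ∷ blocks (y ∷ ys)
        arc≡ = trans (arc-from-u₀ j) (cong (λ r → hE fzero ∷ blocks r) run≡)
        sparse : Sparse (hE fzero ∷ blocks (y ∷ ys))
        sparse = ≤-<-trans (*-monoʳ-≤ 2 (weight-u₀∷blocks≤length y ys cons v∈))
                           (subst (2 * suc (length ys) <_) (cong suc (sym (length-blocks (y ∷ ys)))) (n<1+n _))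

    splittable-forward : ∀ i j → toℕ i ≤ toℕ j → lookup S₁ (fsuc i) ≡ true → lookup S₂ j ≡ true →
                         Splittable (arc (fsuc i) j)
    splittable-forward i j i≤j u∈ v∈ with run-view (toℕ i) j i≤j
    ... | y , ys , run≡ , cons , refl , _ with blocks-ends y ys | toℕ-injective {i = y} {j = i} (proj₁ cons)
    ...   | m , ends | refl = subst Splittable (sym arc≡) (sparse-splittable (fsuc y) (vE y ∷ blocks ys) m _ u∈ ends v∈ sparse)
      where
        arc≡ : arc (fsuc y) j ≡ blocks (y ∷ ys)
        arc≡ = trans (arc-forward y j (toℕ j ∸ toℕ y) (sym (m+[n∸m]≡n i≤j))) (cong blocks run≡)
        sparse : Sparse (blocks (y ∷ ys))
        sparse = ≤-<-trans (*-monoʳ-≤ 2 (blockWeight<length (toℕ y) y ys cons (v∉S₂-if-j≡i u∈ refl) v∈))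
                           (subst (2 * length ys <_) (sym (length-blocks (y ∷ ys))) (*-monoʳ-< 2 (n<1+n _)))

    splittable-wrapping : ∀ i j → toℕ j < toℕ i → lookup S₁ (fsuc i) ≡ true → lookup S₂ j ≡ true →
                          Splittable (arc (fsuc i) j)
    splittable-wrapping i j j<i u∈ v∈ with run-view 0 j z≤n
    ... | y , ys , run≡ , cons , refl , _ with blocks-ends y ys
    ...   | m , ends = subst Splittable (sym arc≡)
      (sparse-splittable (fsuc i) (vE i ∷ blocks rest ++ initial) (length (blocks (i ∷ rest)) + suc m) _ u∈
                         (trans (drop-++ˡ (blocks (i ∷ rest)) initial (suc m)) ends) v∈ sparse)
      where
        rest = drop (suc (toℕ i)) (allFin n)
        initial = hE fzero ∷ blocks (y ∷ ys)
        arc≡ : arc (fsuc i) j ≡ blocks (i ∷ rest) ++ initial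
        arc≡ = trans (arc-wrapping i j (toℕ i ∸ suc (toℕ j)) (sym (m+[n∸m]≡n j<i)))
                     (cong₂ (λ xs r → blocks xs ++ hE fzero ∷ blocks r) (drop-allFin i) run≡)
        a = length (i ∷ rest)
        b = length ys
        length≡ : ∀ a b → 2 * a + suc (2 * suc b) ≡ suc (2 * (a + suc b))
        length≡ = solve-∀
        open ≤-Reasoning
        sparse : Sparse (blocks (i ∷ rest) ++ initial)
        sparse = begin-strict
          2 * count weight (blocks (i ∷ rest) ++ initial)    ≡⟨ cong (2 *_) (count-++ weight (blocks (i ∷ rest)) initial) ⟩
          2 * (blockWeight (i ∷ rest) + count weight initial) ≤⟨ *-monoʳ-≤ 2 (+-mono-≤ (blockWeight≤length (i ∷ rest))
                                                                  (weight-u₀∷blocks≤length y ys cons v∈)) ⟩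
          2 * (a + suc b)                                     <⟨ n<1+n _ ⟩
          suc (2 * (a + suc b))                               ≡⟨ sym (length≡ a b) ⟩
          2 * a + suc (2 * suc b)                             ≡⟨ sym (cong₂ (λ l l′ → l + suc l′) (length-blocks (i ∷ rest))
                                                                                                 (length-blocks (y ∷ ys))) ⟩
          length (blocks (i ∷ rest)) + length initial         ≡⟨ sym (length-++ (blocks (i ∷ rest))) ⟩
          length (blocks (i ∷ rest) ++ initial)               ∎

    arc-splittable : ∀ i j → lookup S₁ i ≡ true → lookup S₂ j ≡ true → Splittable (arc i j)
    arc-splittable fzero    j = splittable-from-u₀ j
    arc-splittable (fsuc i) j with toℕ i ≤? toℕ j
    ... | yes i≤j = splittable-forward i j i≤j
    ... | no  i≰j = splittable-wrapping i j (≰⇒> i≰j)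

  compatible⇒noDiff01 : Compatible n S₁ S₂ → NoDiff01 n S₁ S₂
  compatible⇒noDiff01 compatible i j i∈ j∈ = j≢i i i∈ , j≢i+1 i i∈
    where
      v∈ = []=⇒lookup j∈
      splittable : ∀ i → i ∈ S₁ → Splittable (arc i j)
      splittable i i∈ = Equivalence.to (compatibleAt⇔splittable i j) (compatible i j i∈ j∈)
      j≢i : ∀ i → i ∈ S₁ → ¬ (suc (toℕ j) ≡ toℕ i)
      j≢i fzero    _  ()
      j≢i (fsuc i) i∈ j≡i = unsplittable-adjacent i j ([]=⇒lookup i∈) v∈
        (subst Splittable (arc-adjacent i j (suc-injective j≡i)) (splittable (fsuc i) i∈))
      j≢i+1 : ∀ i → i ∈ S₁ → ¬ (suc (toℕ j) ≡ suc (toℕ i))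
      j≢i+1 fzero    i∈ j≡1 = unsplittable-u₀-v₁ j ([]=⇒lookup i∈) v∈
        (subst Splittable (arc-u₀-v₁ j (suc-injective j≡1)) (splittable fzero i∈))
      j≢i+1 (fsuc i) i∈ j≡i+1 = unsplittable-next i j ([]=⇒lookup i∈) v∈
        (subst Splittable (arc-next i j (suc-injective j≡i+1)) (splittable (fsuc i) i∈))

  noDiff01⇒compatible : NoDiff01 n S₁ S₂ → Compatible n S₁ S₂
  noDiff01⇒compatible noDiff i j i∈ j∈ = Equivalence.from (compatibleAt⇔splittable i j)
    (Sparsity.arc-splittable noDiff i j ([]=⇒lookup i∈) ([]=⇒lookup j∈))

mainTheorem9 : (n : ℕ) (S₁ : Subset (suc n)) (S₂ : Subset n) →
    Compatible n S₁ S₂ ⇔ NoDiff01 n S₁ S₂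
mainTheorem9 n S₁ S₂ = mk⇔ compatible⇒noDiff01 noDiff01⇒compatible
  where open Compatibility n S₁ S₂
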